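{- Let $CC$ be a C-system, $X$ an object of length $m$, $0\le i\le m$, and let $p_{X,i}:X\to ft^i(X)$ be the canonical morphism. Then in $uB(CC)$ one has $s_j(p_{X,i})=\widetilde T_{m-j}(X,\delta(ft^{m-j}(X)))$ for $j=1,\dots,m-i$.
   Context: C-systems: a C0-system is a category $CC$ with a function $l:Ob(CC)\to\mathbb{N}$, an object $pt$, a function $ft:Ob\to Ob$, morphisms $p_X:X\to ft(X)$, and for $l(X)>0$, $f:Y\to ft(X)$ an object $f^*X$ and morphism $q(f,X):f^*X\to X$, such that: $pt$ is the only object of length $0$; $l(ftX)=l(X)-1$ for $l(X)>0$, $ft(pt)=pt$; $pt$ is final; $l(f^*X)>0$, $ft(f^*X)=Y$, $p_X\circ q(f,X)=f\circ p_{f^*X}$ and this square is a pullback; $(id_{ftX})^*X=X$, $q(id,X)=id_X$; $(f\circ g)^*X=g^*(f^*X)$, $q(f\circ g,X)=q(f,X)\circ q(g,f^*X)$. A C-system is a C0-system with, for every $f:Y\to X$ with $l(X)>0$, a morphism $s_f:Y\to(ft(f))^*X$, $ft(f):=p_X\circ f$, with $p_{(ftf)^*X}\circ s_f=id_Y$, $q(ftf,X)\circ s_f=f$, and $s_f=s_{q(g,U)\circ f}$ whenever $X=g^*U$ with $g:ft(X)\to ft(U)$. The canonical morphism $p_{X,i}:X\to ft^i(X)$ is $id_X$ for $i=0$ and $p_{ft^{i-1}(X)}\circ p_{X,i-1}$ for $i\ge1$. $uB(CC)$: $B_n=\{X\mid l(X)=n\}$; $\widetilde B_{n+1}=\{(V,t)\mid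 l(V)=n+1,\ t:ft(V)\to V,\ p_V\circ t=id\}$; $\partial(V,t)=V$. For $f:Y\to ft^i(V)$: $f^*(V,0)=Y$, $q(f,V,0)=f$, $f^*(V,i+1)=q(f,ftV,i)^*V$, $q(f,V,i+1)=q(q(f,ftV,i),V)$. For a section $t$ of $p_V$ and $g:W\to ftV$, $g^*(t):W\to g^*V$ is the unique morphism with $p_{g^*V}\circ g^*(t)=id_W$, $q(g,V)\circ g^*(t)=t\circ g$; $f^*(t,i)=q(f,ftV,i-1)^*(t)$. For $m'\ge n'\ge0$, $Y\in B_{n'+1}$, $(V,t)\in\widetilde B_{m'+1}$ with $ft(Y)=ft^{m'+1-n'}(V)$: $\widetilde T(Y,(V,t))=(p_Y^*(V,m'+1-n'),p_Y^*(t,m'+1-n'))\in\widetilde B_{m'+2}$. For $A\in B_{k+1}$: $\delta(A)=(p_A^*A,d_A)$ where $d_A:A\to p_A^*A$ is the unique morphism with $p_{p_A^*A}\circ d_A=id_A$, $q(p_A,A)\circ d_A=id_A$. Iterated weakening: $\widetilde T_0(Y,r)=r$ and $\widetilde T_j(Y,r)=\widetilde T(Y,\widetilde T_{j-1}(ft(Y),r))$ for $j>0$ (for $Y\in B_{n'+j}$, $r\in\widetilde B_{m'+1}$, $ft^j(Y)=ft^{m'+1-n'}(\partial r)$, $m'\ge n'$). For a morphism $f:Y\to X$ with $l(Y)=n$, $l(X)=m$, the sequence $(s_1(f),\dots,s_m(f))$ in $\widetilde B_{n+1}$ is empty if $m=0$, and for $m\ge1$ equals $(s_1(ft(f)),\dots,s_{m-1}(ft(f)),((ft(f))^*X,s_f))$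 with $ft(f)=p_X\circ f$. -}

module Defs where

-- C-systems (Voevodsky) and the pieces of the B-system uB(CC) needed for Lemma 2.10.
-- Categories are taken with propositional equality on objects and morphisms
-- (Agda's default K is on, so Ob and Hom behave as sets, as in the paper).

open import Level using (Level; _⊔_) renaming (suc to lsuc)
open import Data.Nat using (ℕ; zero; suc; _+_; _∸_; _<_; _≤_; z≤n; s≤s)
open import Data.Nat.Properties
open import Data.Product using (Σ; Σ-syntax; _×_; _,_; proj₁; proj₂)
open import Data.Vec using (Vec; []; _∷ʳ_)
open import Data.Fin using (Fin; toℕ)
open import Data.Fin.Properties using (toℕ<n)
open import Relation.Binary.PropositionalEquality

-- The data of a C-system.
-- pb X f   is  f^*X   (for f : Y → ft X),
-- q X f    is  q(f,X) : f^*X → X,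
-- s X f    is  s_f : Y → (ft f)^*X  where ft f = p_X ∘ f.
-- The operations are total; all axioms about them are only imposed
-- when l(X) > 0, exactly as in the paper (values at l(X) = 0 are never used).

record CSystemData (o h : Level) : Set (lsuc (o ⊔ h)) where
  infixr 9 _∘_
  field
    Ob  : Set o
    Hom : Ob → Ob → Set h
    id  : {X : Ob} → Hom X X
    _∘_ : {X Y Z : Ob} → Hom Y Z → Hom X Y → Hom X Z
    l   : Ob → ℕ
    pt  : Ob
    ft  : Ob → Ob
    p   : (X : Ob) → Hom X (ft X)
    pb  : (X : Ob) {Y : Ob} → Hom Y (ft X) → Ob
    q   : (X : Ob) {Y : Ob} (f : Hom Y (ft X)) → Hom (pb X f) X
    s   : (X : Ob) {Y : Ob} (f : Hom Y X) → Hom Y (pb X (p X ∘ f))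

  cast : {A B : Ob} → A ≡ B → Hom A B
  cast {A} e = subst (Hom A) e id

record IsCSystem {o h : Level} (D : CSystemData o h) : Set (o ⊔ h) where
  open CSystemData D
  field
    idˡ   : {X Y : Ob} (f : Hom X Y) → id ∘ f ≡ f
    idʳ   : {X Y : Ob} (f : Hom X Y) → f ∘ id ≡ f
    assoc : {W X Y Z : Ob} (h : Hom Y Z) (g : Hom X Y) (f : Hom W X) →
            (h ∘ g) ∘ f ≡ h ∘ (g ∘ f)
    l-pt      : l pt ≡ 0
    pt-unique : (X : Ob) → l X ≡ 0 → X ≡ pt
    l-ft  : (X : Ob) → 0 < l X → l (ft X) ≡ l X ∸ 1
    ft-pt : ft pt ≡ pt
    pt-final : (X : Ob) → Σ[ f ∈ Hom X pt ] ((g : Hom X pt) → g ≡ f)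
    l-pb  : (X : Ob) → 0 < l X → {Y : Ob} (f : Hom Y (ft X)) → 0 < l (pb X f)
    ft-pb : (X : Ob) → 0 < l X → {Y : Ob} (f : Hom Y (ft X)) → ft (pb X f) ≡ Y
    pb-comm : (X : Ob) (pos : 0 < l X) {Y : Ob} (f : Hom Y (ft X)) →
              p X ∘ q X f ≡ f ∘ (cast (ft-pb X pos f) ∘ p (pb X f))
    pb-univ : (X : Ob) (pos : 0 < l X) {Y : Ob} (f : Hom Y (ft X))
              {Z : Ob} (a : Hom Z X) (b : Hom Z Y) → p X ∘ a ≡ f ∘ b →
              Σ[ k ∈ Hom Z (pb X f) ]
                ((q X f ∘ k ≡ a) ×
                 (cast (ft-pb X pos f) ∘ (p (pb X f) ∘ k) ≡ b) ×
                 ((k' : Hom Z (pb X f)) → q X f ∘ k' ≡ a →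
                    cast (ft-pb X pos f) ∘ (p (pb X f) ∘ k') ≡ b → k' ≡ k))
    pb-id : (X : Ob) → 0 < l X → pb X (id {ft X}) ≡ X
    q-id  : (X : Ob) (pos : 0 < l X) →
            subst (λ W → Hom W X) (pb-id X pos) (q X id) ≡ id
    pb-comp : (X : Ob) (pos : 0 < l X) {Y Z : Ob} (f : Hom Y (ft X)) (g : Hom Z Y) →
              pb X (f ∘ g) ≡ pb (pb X f) (subst (Hom Z) (sym (ft-pb X pos f)) g)
    q-comp  : (X : Ob) (pos : 0 < l X) {Y Z : Ob} (f : Hom Y (ft X)) (g : Hom Z Y) →
              subst (λ W → Hom W X) (pb-comp X pos f g) (q X (f ∘ g))
                ≡ q X f ∘ q (pb X f) (subst (Hom Z) (sym (ft-pb X pos f)) g)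
    s-sec : (X : Ob) (pos : 0 < l X) {Y : Ob} (f : Hom Y X) →
            cast (ft-pb X pos (p X ∘ f)) ∘ (p (pb X (p X ∘ f)) ∘ s X f) ≡ id
    s-q   : (X : Ob) (pos : 0 < l X) {Y : Ob} (f : Hom Y X) →
            q X (p X ∘ f) ∘ s X f ≡ f
    s-nat : (U : Ob) (pos : 0 < l U) {W : Ob} (g : Hom W (ft U)) {Y : Ob}
            (f : Hom Y (pb U g)) →
            (e : pb (pb U g) (p (pb U g) ∘ f) ≡ pb U (p U ∘ (q U g ∘ f))) →
            subst (Hom Y) e (s (pb U g) f) ≡ s U (q U g ∘ f)

record CSystem (o h : Level) : Set (lsuc (o ⊔ h)) where
  field
    data′     : CSystemData o h
    isCSystem : IsCSystem data′
  open CSystemData data′ public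
  open IsCSystem isCSystem public

module UB {o h : Level} (C : CSystem o h) where
  open CSystem C

  private
    pos-suc : {n : ℕ} → 0 < n → suc (n ∸ 1) ≡ n
    pos-suc {suc n} _ = refl

    pos-of : {X : Ob} {n : ℕ} → l X ≡ suc n → 0 < l X
    pos-of e = subst (0 <_) (sym e) (s≤s z≤n)

  ftⁱ : ℕ → Ob → Ob
  ftⁱ zero    X = X
  ftⁱ (suc i) X = ft (ftⁱ i X)

  pXi : (X : Ob) (i : ℕ) → Hom X (ftⁱ i X)
  pXi X zero    = id
  pXi X (suc i) = p (ftⁱ i X) ∘ pXi X i

  ftⁱ-suc : (i : ℕ) (X : Ob) → ftⁱ (suc i) X ≡ ftⁱ i (ft X)
  ftⁱ-suc zero    X = refl
  ftⁱ-suc (suc i) X = cong ft (ftⁱ-suc i X)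

  l-ft′ : (X : Ob) → l (ft X) ≡ l X ∸ 1
  l-ft′ X with l X in eq
  ... | zero  = trans (cong (λ Z → l (ft Z)) (pt-unique X eq)) (trans (cong l ft-pt) l-pt)
  ... | suc n = trans (l-ft X (subst (0 <_) (sym eq) (s≤s z≤n))) (cong (_∸ 1) eq)

  l-ftⁱ : (i : ℕ) (X : Ob) → l (ftⁱ i X) ≡ l X ∸ i
  l-ftⁱ zero    X = refl
  l-ftⁱ (suc i) X =
    trans (l-ft′ (ftⁱ i X))
      (trans (cong (_∸ 1) (l-ftⁱ i X))
        (trans (∸-+-assoc (l X) i 1) (cong (l X ∸_) (+-comm i 1))))

  l-ftⁱ-≡ : (i : ℕ) {X : Ob} {m : ℕ} → l X ≡ m → l (ftⁱ i X) ≡ m ∸ i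
  l-ftⁱ-≡ i {X} lX = trans (l-ftⁱ i X) (cong (_∸ i) lX)

  l-pb′ : (X : Ob) → 0 < l X → {Y : Ob} (f : Hom Y (ft X)) → l (pb X f) ≡ suc (l Y)
  l-pb′ X pos f =
    trans (sym (pos-suc (l-pb X pos f)))
      (cong suc (trans (sym (l-ft′ (pb X f))) (cong l (ft-pb X pos f))))

  pbⁱ : (V : Ob) (i : ℕ) {Y : Ob} → Hom Y (ftⁱ i V) → Ob
  qⁱ  : (V : Ob) (i : ℕ) {Y : Ob} (f : Hom Y (ftⁱ i V)) → Hom (pbⁱ V i f) V
  pbⁱ V zero    {Y} f = Y
  pbⁱ V (suc i) {Y} f = pb V (qⁱ (ft V) i (subst (Hom Y) (ftⁱ-suc i V) f))
  qⁱ V zero    f = f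
  qⁱ V (suc i) {Y} f = q V (qⁱ (ft V) i (subst (Hom Y) (ftⁱ-suc i V) f))

  l-pbⁱ : (V : Ob) (i : ℕ) {Y : Ob} (f : Hom Y (ftⁱ i V)) → i ≤ l V →
          l (pbⁱ V i f) ≡ i + l Y
  l-pbⁱ V zero    f le = refl
  l-pbⁱ V (suc i) {Y} f le =
    trans (l-pb′ V (≤-trans (s≤s z≤n) le) _)
      (cong suc (l-pbⁱ (ft V) i _ (subst (i ≤_) (sym (l-ft′ V)) (∸-monoˡ-≤ 1 le))))

  ft-pbⁱ : (V : Ob) (i : ℕ) {Y : Ob} (f : Hom Y (ftⁱ i V)) → i ≤ l V →
           ftⁱ i (pbⁱ V i f) ≡ Y
  ft-pbⁱ V zero    f le = refl
  ft-pbⁱ V (suc i) {Y} f le =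
    trans (ftⁱ-suc i _)
      (trans (cong (ftⁱ i) (ft-pb V (≤-trans (s≤s z≤n) le) _))
        (ft-pbⁱ (ft V) i _ (subst (i ≤_) (sym (l-ft′ V)) (∸-monoˡ-≤ 1 le))))

  sec-lemma : {V W : Ob} (e : ft V ≡ W) (k : Hom W V) →
              cast e ∘ (p V ∘ k) ≡ id → p V ∘ (k ∘ cast e) ≡ id
  sec-lemma {V} refl k hyp = trans (cong (p V ∘_) (idʳ k)) (trans (sym (idˡ _)) hyp)

  -- elements of \widetilde B_{n+1}:  (V,t) with l(V) = n+1, t : ft V → V, p_V ∘ t = id
  record B̃ (n : ℕ) : Set (o ⊔ h) where
    constructor mkB̃
    field
      V   : Ob
      len : l V ≡ suc n
      t   : Hom (ft V) V
      sec : p V ∘ t ≡ id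

  -- the underlying pair (V,t); equality in \widetilde B is equality of these pairs
  raw : {n : ℕ} → B̃ n → Σ Ob (λ V → Hom (ft V) V)
  raw r = B̃.V r , B̃.t r

  ∂ : {n : ℕ} → B̃ n → Ob
  ∂ = B̃.V

  pbSec : (V : Ob) → 0 < l V → (t : Hom (ft V) V) → p V ∘ t ≡ id →
          {W : Ob} (g : Hom W (ft V)) → Hom W (pb V g)
  pbSec V pos t sec g = proj₁ (pb-univ V pos g (t ∘ g) id eq)
    where
      eq : p V ∘ (t ∘ g) ≡ g ∘ id
      eq = trans (sym (assoc _ _ _)) (trans (cong (_∘ g) sec) (trans (idˡ g) (sym (idʳ g))))

  pbSec-sec : (V : Ob) (pos : 0 < l V) (t : Hom (ft V) V) (sec : p V ∘ t ≡ id)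
              {W : Ob} (g : Hom W (ft V)) →
              cast (ft-pb V pos g) ∘ (p (pb V g) ∘ pbSec V pos t sec g) ≡ id
  pbSec-sec V pos t sec g =
    proj₁ (proj₂ (proj₂ (pb-univ V pos g (t ∘ g) id
      (trans (sym (assoc _ _ _)) (trans (cong (_∘ g) sec) (trans (idˡ g) (sym (idʳ g))))))))

  pbSecⁱ : (V : Ob) (pos : 0 < l V) (t : Hom (ft V) V) (sec : p V ∘ t ≡ id)
           (i : ℕ) {Y : Ob} (f : Hom Y (ftⁱ (suc i) V)) →
           Hom (pbⁱ (ft V) i (subst (Hom Y) (ftⁱ-suc i V) f)) (pbⁱ V (suc i) f)
  pbSecⁱ V pos t sec i {Y} f =
    pbSec V pos t sec (qⁱ (ft V) i (subst (Hom Y) (ftⁱ-suc i V) f))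

  d : (A : Ob) → 0 < l A → Hom A (pb A (p A))
  d A pos = proj₁ (pb-univ A pos (p A) id id refl)

  δ : (A : Ob) (k : ℕ) → l A ≡ suc k → B̃ (suc k)
  δ A k lA = mkB̃ (pb A (p A)) (trans (l-pb′ A pos (p A)) (cong suc lA))
                 (d A pos ∘ cast (ft-pb A pos (p A)))
                 (sec-lemma (ft-pb A pos (p A)) (d A pos)
                    (proj₁ (proj₂ (proj₂ (pb-univ A pos (p A) id id refl)))))
    where
      pos : 0 < l A
      pos = pos-of lA

  -- \widetilde T(Y,(V,t)) = (p_Y^*(V,k), p_Y^*(t,k)),  k = m'+1-n',
  -- for Y ∈ B_{n'+1}, (V,t) ∈ \widetilde B_{m'+1}, m' ≥ n', ft(Y) = ft^k(V);
  -- result in \widetilde B_{m'+2}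
  T̃ : (n' m' : ℕ) → n' ≤ m' → (Y : Ob) → l Y ≡ suc n' → (r : B̃ m') →
      ft Y ≡ ftⁱ (suc m' ∸ n') (∂ r) → B̃ (suc m')
  T̃ n' m' le Y lY (mkB̃ V lV t sec) e = mkB̃ (pbⁱ V (suc k') f) len' t' sec'
    where
      k' : ℕ
      k' = m' ∸ n'
      posV : 0 < l V
      posV = pos-of lV
      f : Hom Y (ftⁱ (suc k') V)
      f = subst (Hom Y) (trans e (cong (λ k → ftⁱ k V) (+-∸-assoc 1 le))) (p Y)
      g : Hom (pbⁱ (ft V) k' (subst (Hom Y) (ftⁱ-suc k' V) f)) (ft V)
      g = qⁱ (ft V) k' (subst (Hom Y) (ftⁱ-suc k' V) f)
      t' : Hom (ft (pbⁱ V (suc k') f)) (pbⁱ V (suc k') f)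
      t' = pbSecⁱ V posV t sec k' f ∘ cast (ft-pb V posV g)
      sec' : p (pbⁱ V (suc k') f) ∘ t' ≡ id
      sec' = sec-lemma (ft-pb V posV g) _ (pbSec-sec V posV t sec g)
      len' : l (pbⁱ V (suc k') f) ≡ suc (suc m')
      len' = trans (l-pbⁱ V (suc k') f (subst (suc k' ≤_) (sym lV) (s≤s (m∸n≤m m' n'))))
               (trans (cong (suc k' +_) lY)
                 (cong suc (trans (+-suc k' n') (cong suc (m∸n+n≡m le)))))

  ∂T̃ : (n' m' : ℕ) (le : n' ≤ m') (Y : Ob) (lY : l Y ≡ suc n') (r : B̃ m')
       (e : ft Y ≡ ftⁱ (suc m' ∸ n') (∂ r)) →
       ftⁱ (suc m' ∸ n') (∂ (T̃ n' m' le Y lY r e)) ≡ Y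
  ∂T̃ n' m' le Y lY (mkB̃ V lV t sec) e =
    trans (cong (λ k → ftⁱ k (∂ (T̃ n' m' le Y lY (mkB̃ V lV t sec) e))) (+-∸-assoc 1 le))
      (ft-pbⁱ V (suc (m' ∸ n')) _ (subst (suc (m' ∸ n') ≤_) (sym lV) (s≤s (m∸n≤m m' n'))))

  private
    arith : (j m' n' : ℕ) → suc (j + m') ∸ (j + n') ≡ suc m' ∸ n'
    arith j m' n' = trans (cong (_∸ (j + n')) (sym (+-suc j m'))) ([m+n]∸[m+o]≡n∸o j (suc m') n')

  T̃ⱼ  : (j n' m' : ℕ) → n' ≤ m' → (Y : Ob) → l Y ≡ j + n' → (r : B̃ m') →
        ftⁱ j Y ≡ ftⁱ (suc m' ∸ n') (∂ r) → B̃ (j + m')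
  ∂T̃ⱼ : (j n' m' : ℕ) (le : n' ≤ m') (Y : Ob) (lY : l Y ≡ j + n') (r : B̃ m')
        (e : ftⁱ j Y ≡ ftⁱ (suc m' ∸ n') (∂ r)) →
        ftⁱ (suc m' ∸ n') (∂ (T̃ⱼ j n' m' le Y lY r e)) ≡ Y
  T̃ⱼ zero    n' m' le Y lY r e = r
  T̃ⱼ (suc j) n' m' le Y lY r e =
    T̃ (j + n') (j + m') (+-monoʳ-≤ j le) Y lY
      (T̃ⱼ j n' m' le (ft Y) lftY r e₁)
      (trans (sym (∂T̃ⱼ j n' m' le (ft Y) lftY r e₁))
             (cong (λ k → ftⁱ k (∂ (T̃ⱼ j n' m' le (ft Y) lftY r e₁))) (sym (arith j m' n'))))
    where
      lftY : l (ft Y) ≡ j + n'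
      lftY = trans (l-ft′ Y) (cong (_∸ 1) lY)
      e₁ : ftⁱ j (ft Y) ≡ ftⁱ (suc m' ∸ n') (∂ r)
      e₁ = trans (sym (ftⁱ-suc j Y)) e
  ∂T̃ⱼ zero    n' m' le Y lY r e = sym e
  ∂T̃ⱼ (suc j) n' m' le Y lY r e =
    trans (cong (λ k → ftⁱ k (∂ (T̃ⱼ (suc j) n' m' le Y lY r e))) (sym (arith j m' n')))
      (∂T̃ (j + n') (j + m') (+-monoʳ-≤ j le) Y lY (T̃ⱼ j n' m' le (ft Y) lftY r e₁) _)
    where
      lftY : l (ft Y) ≡ j + n'
      lftY = trans (l-ft′ Y) (cong (_∸ 1) lY)
      e₁ : ftⁱ j (ft Y) ≡ ftⁱ (suc m' ∸ n') (∂ r)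
      e₁ = trans (sym (ftⁱ-suc j Y)) e

  sseq : (n : ℕ) {Y : Ob} → l Y ≡ n → (m : ℕ) {X : Ob} → l X ≡ m →
         Hom Y X → Vec (B̃ n) m
  sseq n lY zero    lX f = []
  sseq n {Y} lY (suc m) {X} lX f =
    sseq n lY m (trans (l-ft′ X) (cong (_∸ 1) lX)) (p X ∘ f)
      ∷ʳ mkB̃ (pb X (p X ∘ f)) (trans (l-pb′ X pos (p X ∘ f)) (cong suc lY))
             (s X f ∘ cast (ft-pb X pos (p X ∘ f)))
             (sec-lemma (ft-pb X pos (p X ∘ f)) (s X f) (s-sec X pos f))
    where
      pos : 0 < l X
      pos = pos-of lX

  -- for J = suc k with 1 ≤ J ≤ m and l(X) = m:
  -- \widetilde T_{m-J}(X, δ(ft^{m-J}(X)))  ∈ \widetilde B_{m+1}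
  -- (here n' = m' = J, and δ(ft^{m-J} X) ∈ \widetilde B_{J+1})
  weakδ : (m : ℕ) (X : Ob) → l X ≡ m → (k : ℕ) → suc k ≤ m →
          B̃ ((m ∸ suc k) + suc k)
  weakδ m X lX k le =
    T̃ⱼ (m ∸ suc k) (suc k) (suc k) ≤-refl X (trans lX (sym (m∸n+n≡m le)))
       (δ A k lA)
       (sym (trans (cong (λ i → ftⁱ i (pb A (p A))) (m+n∸n≡m 1 k))
                   (ft-pb A (pos-of lA) (p A))))
    where
      A : Ob
      A = ftⁱ (m ∸ suc k) X
      lA : l A ≡ suc k
      lA = trans (l-ftⁱ-≡ (m ∸ suc k) lX) (m∸[m∸n]≡n le)

  -- an index j : Fin (m ∸ i) stands for the paper's index toℕ j + 1 ∈ {1,…,m-i}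
  fin-bound : (m i : ℕ) (j : Fin (m ∸ i)) → suc (toℕ j) ≤ m
  fin-bound m i j = ≤-trans (toℕ<n j) (m∸n≤m m i)

module Submission where

-- Every entry of s_•(f) for f : Y → A is a "section pair" ((p_A ∘ f)^*A, s_f),
-- written sPair A f.  The proof identifies both sides with such pairs.
--   * Pullback facts: a section of p over a pullback g^*V is determined by its
--     composite with q(g,V) (sectionOver-unique); together with the axiom
--     s_f = s_{q(g,U) ∘ f} this gives the naturality sPair (g^*A) k = sPair A (q ∘ k).
--   * Base case: δ(A) = sPair A id.
--   * One weakening step: T̃(X, sPair A h) = sPair A (h ∘ p_X)  for h : ft X → A.
--   * Induction on k: T̃_k(X, δ(ft^k X)) = sPair (ft^k X) p_{X,k}.
--   * The j-th entry of s_•(p_{X,i}) is sPair (ft^{m-j} X) p_{X,m-j}, by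
--     induction on the length of the sequence (it is built by appending on the right).
-- The theorem is the combination of the last two facts.

open import Defs
open import Level using (Level; _⊔_)
open import Data.Nat using (ℕ; _∸_; _≤_; zero; suc; _+_; _<_; s≤s; z≤n)
open import Data.Nat.Properties
  using (≤-irrelevant; +-monoʳ-≤; n∸n≡0; m∸[m∸n]≡n; m∸n≢0⇒n<m; 0≢1+n; <⇒≤)
open import Data.Fin using (Fin; toℕ; inject₁; fromℕ) renaming (zero to fzero; suc to fsuc)
open import Data.Fin.Properties using (toℕ-inject₁; toℕ-fromℕ)
open import Data.Vec using (Vec; []; _∷_; _∷ʳ_; lookup)
open import Data.Product using (Σ; _,_; proj₁; proj₂)
open import Axiom.UniquenessOfIdentityProofs.WithK using (uip)
open import Relation.Binary.PropositionalEquality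

data InjectOrLast : (n : ℕ) → Fin (suc n) → Set where
  old  : {n : ℕ} (j : Fin n) → InjectOrLast n (inject₁ j)
  last : {n : ℕ} → InjectOrLast n (fromℕ n)

injectOrLast : (n : ℕ) (j : Fin (suc n)) → InjectOrLast n j
injectOrLast zero    fzero    = last
injectOrLast (suc n) fzero    = old fzero
injectOrLast (suc n) (fsuc j) with injectOrLast n j
... | old j' = old (fsuc j')
... | last   = last

lookup-∷ʳ-inject₁ : ∀ {a} {A : Set a} {n : ℕ} (xs : Vec A n) (x : A) (j : Fin n) →
                    lookup (xs ∷ʳ x) (inject₁ j) ≡ lookup xs j
lookup-∷ʳ-inject₁ (y ∷ xs) x fzero    = refl
lookup-∷ʳ-inject₁ (y ∷ xs) x (fsuc j) = lookup-∷ʳ-inject₁ xs x j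

lookup-∷ʳ-last : ∀ {a} {A : Set a} {n : ℕ} (xs : Vec A n) (x : A) →
                 lookup (xs ∷ʳ x) (fromℕ n) ≡ x
lookup-∷ʳ-last []       x = refl
lookup-∷ʳ-last (y ∷ xs) x = lookup-∷ʳ-last xs x

∸-complement : (m i n : ℕ) → m ∸ i ≡ suc n → m ∸ suc n ≡ i
∸-complement m i n e =
  trans (cong (m ∸_) (sym e)) (m∸[m∸n]≡n (<⇒≤ (m∸n≢0⇒n<m (λ e₀ → 0≢1+n (trans (sym e₀) e)))))

module SectionPairs {o h : Level} (C : CSystem o h) where
  open CSystem C
  open UB C

  Pair : Set (o ⊔ h)
  Pair = Σ Ob (λ V → Hom (ft V) V)

  sectionOver : (V : Ob) → 0 < l V → {Y : Ob} (g : Hom Y (ft V)) → Hom Y (pb V g) → Pair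
  sectionOver V pos g k = pb V g , k ∘ cast (ft-pb V pos g)

  sPair : (A : Ob) → 0 < l A → {Y : Ob} → Hom Y A → Pair
  sPair A pos f = sectionOver A pos (p A ∘ f) (s A f)

  sPair-cong : (A : Ob) (pos pos' : 0 < l A) {Y : Ob} {f f' : Hom Y A} → f ≡ f' →
               sPair A pos f ≡ sPair A pos' f'
  sPair-cong A pos pos' refl rewrite ≤-irrelevant pos pos' = refl

  cast-subst : {Y B B' : Ob} (c : B' ≡ B) (e : B ≡ B') (x : Hom Y B) →
               cast c ∘ subst (Hom Y) e x ≡ x
  cast-subst refl refl x = idˡ x

  subst-cast : {Y B B' : Ob} (c : B ≡ B') (x : Hom Y B) →
               subst (Hom Y) (sym c) (cast c ∘ x) ≡ x
  subst-cast refl x = idˡ x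

  pb-comm-∘ : (V : Ob) (pos : 0 < l V) {Y : Ob} (g : Hom Y (ft V)) {Z : Ob} (k : Hom Z (pb V g)) →
              p V ∘ (q V g ∘ k) ≡ g ∘ (cast (ft-pb V pos g) ∘ (p (pb V g) ∘ k))
  pb-comm-∘ V pos g k = begin
    p V ∘ (q V g ∘ k)                               ≡⟨ sym (assoc _ _ _) ⟩
    (p V ∘ q V g) ∘ k                               ≡⟨ cong (_∘ k) (pb-comm V pos g) ⟩
    (g ∘ (cast (ft-pb V pos g) ∘ p (pb V g))) ∘ k   ≡⟨ assoc _ _ _ ⟩
    g ∘ ((cast (ft-pb V pos g) ∘ p (pb V g)) ∘ k)   ≡⟨ cong (g ∘_) (assoc _ _ _) ⟩
    g ∘ (cast (ft-pb V pos g) ∘ (p (pb V g) ∘ k))   ∎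
    where open ≡-Reasoning

  -- By the pullback property, a section k of p over g^*V is determined by q(g,V) ∘ k.
  sectionOver-unique :
    (V : Ob) (pos₁ pos₂ : 0 < l V) {Y : Ob} {g₁ g₂ : Hom Y (ft V)} → g₁ ≡ g₂ →
    (k₁ : Hom Y (pb V g₁)) (k₂ : Hom Y (pb V g₂)) (a : Hom Y V) →
    q V g₁ ∘ k₁ ≡ a → cast (ft-pb V pos₁ g₁) ∘ (p (pb V g₁) ∘ k₁) ≡ id →
    q V g₂ ∘ k₂ ≡ a → cast (ft-pb V pos₂ g₂) ∘ (p (pb V g₂) ∘ k₂) ≡ id →
    sectionOver V pos₁ g₁ k₁ ≡ sectionOver V pos₂ g₂ k₂
  sectionOver-unique V pos₁ pos₂ {g₁ = g} refl k₁ k₂ a q₁ s₁ q₂ s₂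
    rewrite ≤-irrelevant pos₁ pos₂ =
      cong (sectionOver V pos₂ g) (trans (unique k₁ q₁ s₁) (sym (unique k₂ q₂ s₂)))
    where
      square : p V ∘ a ≡ g ∘ id
      square = trans (cong (p V ∘_) (sym q₁)) (trans (pb-comm-∘ V pos₂ g k₁) (cong (g ∘_) s₁))
      unique = proj₂ (proj₂ (proj₂ (pb-univ V pos₂ g a id square)))

  pair-transport : {O₁ O₂ : Ob} (e : O₁ ≡ O₂) {Y : Ob} (k₁ : Hom Y O₁) (k₂ : Hom Y O₂) →
                   subst (Hom Y) e k₁ ≡ k₂ → (c₁ : ft O₁ ≡ Y) (c₂ : ft O₂ ≡ Y) →
                   _≡_ {A = Pair} (O₁ , k₁ ∘ cast c₁) (O₂ , k₂ ∘ cast c₂)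
  pair-transport refl k₁ .k₁ refl c₁ c₂ rewrite uip c₁ c₂ = refl

  -- (p_{g^*A} ∘ k)^*(g^*A) = (p_A ∘ q(g,A) ∘ k)^*A, by functoriality of pullback.
  pb-of-pb : (A : Ob) (posA : 0 < l A) {W : Ob} (g : Hom W (ft A)) {Y : Ob} (k : Hom Y (pb A g)) →
             pb (pb A g) (p (pb A g) ∘ k) ≡ pb A (p A ∘ (q A g ∘ k))
  pb-of-pb A posA g k =
    trans (cong (pb (pb A g)) (sym (subst-cast c (p (pb A g) ∘ k))))
      (trans (sym (pb-comp A posA g (cast c ∘ (p (pb A g) ∘ k))))
        (cong (pb A) (sym (pb-comm-∘ A posA g k))))
    where c = ft-pb A posA g

  -- Naturality of section pairs, the pair form of the axiom s_k = s_{q(g,A) ∘ k}.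
  sPair-pb : (A : Ob) (posA : 0 < l A) {W : Ob} (g : Hom W (ft A))
             (posV : 0 < l (pb A g)) {Y : Ob} (k : Hom Y (pb A g)) →
             sPair (pb A g) posV k ≡ sPair A posA (q A g ∘ k)
  sPair-pb A posA g posV k =
    pair-transport (pb-of-pb A posA g k) _ _ (s-nat A posA g k (pb-of-pb A posA g k)) _ _

  pbSec-sPair : (V : Ob) (pos : 0 < l V) (t : Hom (ft V) V) (sec : p V ∘ t ≡ id)
                {W : Ob} (f : Hom W (ft V)) →
                sectionOver V pos f (pbSec V pos t sec f) ≡ sPair V pos (t ∘ f)
  pbSec-sPair V pos t sec f =
    sectionOver-unique V pos pos f≡ (pbSec V pos t sec f) (s V (t ∘ f)) (t ∘ f)
      (proj₁ (proj₂ (pb-univ V pos f (t ∘ f) id _))) (pbSec-sec V pos t sec f)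
      (s-q V pos (t ∘ f)) (s-sec V pos (t ∘ f))
    where
      f≡ : f ≡ p V ∘ (t ∘ f)
      f≡ = sym (trans (sym (assoc _ _ _)) (trans (cong (_∘ f) sec) (idˡ f)))

  δ-sPair : (A : Ob) (k : ℕ) (lA : l A ≡ suc k) (pos : 0 < l A) → raw (δ A k lA) ≡ sPair A pos id
  δ-sPair A k lA pos =
    sectionOver-unique A _ pos (sym (idʳ (p A))) (d A _) (s A id) id
      (proj₁ (proj₂ (pb-univ A _ (p A) id id refl)))
      (proj₁ (proj₂ (proj₂ (pb-univ A _ (p A) id id refl))))
      (s-q A pos id) (s-sec A pos id)

  -- The pair underlying T̃(Y,(V,t)), with k' standing for m'-n'.
  weakenedPair : (V : Ob) (pos : 0 < l V) (t : Hom (ft V) V) (sec : p V ∘ t ≡ id)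
                 (Y : Ob) (k' : ℕ) (f : Hom Y (ftⁱ (suc k') V)) → Pair
  weakenedPair V pos t sec Y k' f =
    pbⁱ V (suc k') f ,
    pbSecⁱ V pos t sec k' f ∘ cast (ft-pb V pos (qⁱ (ft V) k' (subst (Hom Y) (ftⁱ-suc k' V) f)))

  weaken-sPair : (A : Ob) (posA : 0 < l A) (X : Ob) (h : Hom (ft X) A)
                 (V : Ob) (t : Hom (ft V) V) (sec : p V ∘ t ≡ id) (posV : 0 < l V) →
                 _≡_ {A = Pair} (V , t) (sPair A posA h) →
                 (k' : ℕ) → k' ≡ 0 → (E : ft X ≡ ftⁱ (suc k') V) →
                 weakenedPair V posV t sec X k' (subst (Hom X) E (p X)) ≡ sPair A posA (h ∘ p X)
  weaken-sPair A posA X h ._ ._ sec posV refl .0 refl E = begin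
    sectionOver V posV f (pbSec V posV t sec f) ≡⟨ pbSec-sPair V posV t sec f ⟩
    sPair V posV (t ∘ f)                        ≡⟨ sPair-pb A posA g posV (t ∘ f) ⟩
    sPair A posA (q A g ∘ (t ∘ f))              ≡⟨ sPair-cong A posA posA q∘t∘f ⟩
    sPair A posA (h ∘ p X)                      ∎
    where
      open ≡-Reasoning
      g = p A ∘ h
      V = pb A g
      c = ft-pb A posA g
      t = s A h ∘ cast c
      f = subst (Hom X) E (p X)
      q∘t∘f : q A g ∘ (t ∘ f) ≡ h ∘ p X
      q∘t∘f = begin
        q A g ∘ ((s A h ∘ cast c) ∘ f) ≡⟨ cong (q A g ∘_) (assoc _ _ _) ⟩
        q A g ∘ (s A h ∘ (cast c ∘ f)) ≡⟨ sym (assoc _ _ _) ⟩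
        (q A g ∘ s A h) ∘ (cast c ∘ f) ≡⟨ cong (_∘ (cast c ∘ f)) (s-q A posA h) ⟩
        h ∘ (cast c ∘ f)               ≡⟨ cong (h ∘_) (cast-subst c E (p X)) ⟩
        h ∘ p X                        ∎

  -- The same statement for T̃ itself, where m' - n' = n - n is only propositionally 0.
  T̃-sPair : (n : ℕ) (le : n ≤ n) (X : Ob) (lX : l X ≡ suc n) (r : B̃ n)
            (e : ft X ≡ ftⁱ (suc n ∸ n) (∂ r))
            (A : Ob) (posA : 0 < l A) (h : Hom (ft X) A) → raw r ≡ sPair A posA h →
            raw (T̃ n n le X lX r e) ≡ sPair A posA (h ∘ p X)
  T̃-sPair n le X lX (mkB̃ V lV t sec) e A posA h r≡ =
    weaken-sPair A posA X h V t sec _ r≡ (n ∸ n) (n∸n≡0 n) _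

  pXi-suc : (k : ℕ) (X : Ob) → subst (Hom X) (ftⁱ-suc k X) (pXi X (suc k)) ≡ pXi (ft X) k ∘ p X
  pXi-suc zero    X = trans (idʳ _) (sym (idˡ _))
  pXi-suc (suc k) X =
    trans (subst-p (ftⁱ-suc k X) (pXi X (suc k)))
      (trans (cong (p (ftⁱ k (ft X)) ∘_) (pXi-suc k X)) (sym (assoc _ _ _)))
    where
      subst-p : {B B' : Ob} (e : B ≡ B') (u : Hom X B) →
                subst (Hom X) (cong ft e) (p B ∘ u) ≡ p B' ∘ subst (Hom X) e u
      subst-p refl u = refl

  pXi-suc-at : (k : ℕ) (X A : Ob) (E : ftⁱ (suc k) X ≡ A) (E' : ftⁱ k (ft X) ≡ A) →
               subst (Hom X) E (pXi X (suc k)) ≡ subst (Hom (ft X)) E' (pXi (ft X) k) ∘ p X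
  pXi-suc-at k X ._ E refl rewrite uip E (ftⁱ-suc k X) = pXi-suc k X

  T̃ⱼ-δ : (K k : ℕ) (le : suc K ≤ suc K) (X A : Ob) (E : ftⁱ k X ≡ A) (lA : l A ≡ suc K)
         (posA : 0 < l A) (lX : l X ≡ k + suc K)
         (e : ftⁱ k X ≡ ftⁱ (suc (suc K) ∸ suc K) (∂ (δ A K lA))) →
         raw (T̃ⱼ k (suc K) (suc K) le X lX (δ A K lA) e) ≡ sPair A posA (subst (Hom X) E (pXi X k))
  T̃ⱼ-δ K zero    le X ._ refl lA posA lX e = δ-sPair X K lA posA
  T̃ⱼ-δ K (suc k) le X A E lA posA lX e =
    trans (T̃-sPair (k + suc K) (+-monoʳ-≤ k le) X lX r _ A posA _ (T̃ⱼ-δ K k le (ft X) A E' lA posA lftX _))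
      (sPair-cong A posA posA (sym (pXi-suc-at k X A E E')))
    where
      E' : ftⁱ k (ft X) ≡ A
      E' = trans (sym (ftⁱ-suc k X)) E
      lftX : l (ft X) ≡ k + suc K
      lftX = trans (l-ft′ X) (cong (_∸ 1) lX)
      r : B̃ (k + suc K)
      r = T̃ⱼ k (suc K) (suc K) le (ft X) lftX (δ A K lA) (trans (sym (ftⁱ-suc k X)) e)

  module _ (m : ℕ) (X : Ob) (lX : l X ≡ m) where
    weakδ-cong : {k k' : ℕ} → k ≡ k' → (b : suc k ≤ m) (b' : suc k' ≤ m) →
                 raw (weakδ m X lX k b) ≡ raw (weakδ m X lX k' b')
    weakδ-cong refl b b' rewrite ≤-irrelevant b b' = refl

    sPair-pXi-cong : {k i : ℕ} → k ≡ i → (pos : 0 < l (ftⁱ k X)) (pos' : 0 < l (ftⁱ i X)) →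
                     sPair (ftⁱ k X) pos (pXi X k) ≡ sPair (ftⁱ i X) pos' (pXi X i)
    sPair-pXi-cong refl pos pos' = sPair-cong _ pos pos' refl

    sseq-pXi : (n i : ℕ) (lXi : l (ftⁱ i X) ≡ n) (j : Fin n) (b : suc (toℕ j) ≤ m) →
               raw (lookup (sseq m lX n lXi (pXi X i)) j) ≡ raw (weakδ m X lX (toℕ j) b)
    sseq-pXi (suc n) i lXi j b = byPosition j b (injectOrLast n j)
      where
        earlier = sseq m lX n (trans (l-ft′ (ftⁱ i X)) (cong (_∸ 1) lXi)) (pXi X (suc i))
        m-n-1≡i : m ∸ suc n ≡ i
        m-n-1≡i = ∸-complement m i n (trans (sym (l-ftⁱ-≡ i lX)) lXi)
        posi : 0 < l (ftⁱ i X)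
        posi = subst (0 <_) (sym lXi) (s≤s z≤n)
        pos' : 0 < l (ftⁱ (m ∸ suc n) X)
        pos' = subst (λ z → 0 < l (ftⁱ z X)) (sym m-n-1≡i) posi
        byPosition : (j : Fin (suc n)) (b : suc (toℕ j) ≤ m) → InjectOrLast n j →
                     raw (lookup (sseq m lX (suc n) lXi (pXi X i)) j) ≡ raw (weakδ m X lX (toℕ j) b)
        byPosition ._ b (old j') =
          trans (cong raw (lookup-∷ʳ-inject₁ earlier _ j'))
            (trans (sseq-pXi n (suc i) _ j' b') (weakδ-cong (sym (toℕ-inject₁ j')) b' b))
          where b' = subst (λ z → suc z ≤ m) (toℕ-inject₁ j') b
        byPosition ._ b last =
          trans (cong raw (lookup-∷ʳ-last earlier _))
            (trans (sym (sPair-pXi-cong m-n-1≡i pos' posi))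
              (trans (sym (T̃ⱼ-δ n (m ∸ suc n) _ X _ refl _ pos' _ _))
                (weakδ-cong (sym (toℕ-fromℕ n)) b' b)))
          where b' = subst (λ z → suc z ≤ m) (toℕ-fromℕ n) b

lemma2p10 : {o h : Level} (C : CSystem o h) →
    let open CSystem C in
    let open UB C in
    (m : ℕ) (X : Ob) (lX : l X ≡ m) (i : ℕ) (i≤m : i ≤ m) (j : Fin (m ∸ i)) →
    raw (lookup (sseq m lX (m ∸ i) (l-ftⁱ-≡ i lX) (pXi X i)) j)
      ≡ raw (weakδ m X lX (toℕ j) (fin-bound m i j))
lemma2p10 C m X lX i i≤m j =
  SectionPairs.sseq-pXi C m X lX (m ∸ i) i (UB.l-ftⁱ-≡ C i lX) j (UB.fin-bound C m i j)
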